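{- Let $n, r \geq 1$. Then \[ \mathcal{S}_{(r,n)}(x) = (-1)^{r} r!\, \frac{(x-1)^{r+n} - x^{n+1} \psi_{(r,n)}(x)}{(n+1) \cdots (n+r)}, \] where \[ \psi_{(r,n)}(x) = \sum_{k=0}^{r-1} \binom{n+k}{k} (-1)^k (x-1)^{r-1-k} = \sum_{k=0}^{r-1} \binom{n+r}{k} (-1)^k x^{r-1-k}. \] In particular: (i) $\mathcal{S}_{(1,n)}(x) = \frac{x^{n+1}-(x-1)^{n+1}}{n+1}$; (ii) $\mathcal{S}_{(r,1)}(x) = x - \frac{1}{r+1}$; (iii) $\mathcal{S}_{(r,n)}(2) = (-1)^{r} r!\, \frac{1 - 2^{n+1} \sum_{k=0}^{r-1} (-1)^k \binom{n+k}{k}}{(n+1) \cdots (n+r)}$.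
   Context: For integers $n, r \geq 0$, $\mathcal{S}_{(r,n)}(x) = \sum_{k=0}^{n} \binom{n}{k} (-1)^k x^{n-k} \binom{r+k}{r}^{ -1} \in \mathbb{Q}[x]$. -}

module Defs where

open import Data.Nat as ℕ using (ℕ; zero; suc; _∸_; _≤_; z≤n; s≤s; NonZero; >-nonZero)
open import Data.Nat.Properties as ℕP using (≤-trans; m≤m+n)
open import Data.Nat.Combinatorics using (_C_; nCk≡nPk/k!; nCk+nC[k+1]≡[n+1]C[k+1])
open import Data.Integer using (+_)
open import Data.Rational using (ℚ; 0ℚ; 1ℚ; _+_; _*_; _-_; -_; _/_)
open import Relation.Binary.PropositionalEquality using (_≡_; refl; sym; subst)

ℕ→ℚ : ℕ → ℚ
ℕ→ℚ m = + m / 1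

infixr 8 _^ℚ_
_^ℚ_ : ℚ → ℕ → ℚ
x ^ℚ zero  = 1ℚ
x ^ℚ suc m = x * (x ^ℚ m)

sgn : ℕ → ℚ
sgn k = (- 1ℚ) ^ℚ k

sumBelow : ℕ → (ℕ → ℚ) → ℚ
sumBelow zero    f = 0ℚ
sumBelow (suc m) f = sumBelow m f + f m

C-pos : ∀ n k → k ≤ n → 0 ℕ.< n C k
C-pos n zero _ = subst (0 ℕ.<_) (sym (nCk≡nPk/k! {0} {n} z≤n)) (s≤s z≤n)
C-pos (suc n) (suc k) (s≤s k≤n) =
  subst (0 ℕ.<_) (nCk+nC[k+1]≡[n+1]C[k+1] n k)
    (ℕP.<-≤-trans (C-pos n k k≤n) (m≤m+n (n C k) (n C suc k)))

invBinom : ℕ → ℕ → ℚ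
invBinom r k = (+ 1 / ((r ℕ.+ k) C r)) {{>-nonZero (C-pos (r ℕ.+ k) r (m≤m+n r k))}}

risingProd : ℕ → ℕ → ℕ
risingProd n zero    = 1
risingProd n (suc r) = risingProd n r ℕ.* (n ℕ.+ suc r)

risingProd-pos : ∀ n r → 0 ℕ.< risingProd n r
risingProd-pos n zero    = s≤s z≤n
risingProd-pos n (suc r) =
  ℕP.*-mono-< {0} {risingProd n r} {0} {n ℕ.+ suc r}
    (risingProd-pos n r) (ℕP.<-≤-trans (s≤s z≤n) (ℕP.m≤n+m (suc r) n))

invRising : ℕ → ℕ → ℚ
invRising n r = (+ 1 / risingProd n r) {{>-nonZero (risingProd-pos n r)}}

S : ℕ → ℕ → ℚ → ℚ
S r n x = sumBelow (suc n) λ k →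
  ℕ→ℚ (n C k) * sgn k * (x ^ℚ (n ∸ k)) * invBinom r k

ψ : ℕ → ℕ → ℚ → ℚ
ψ r n x = sumBelow r λ k →
  ℕ→ℚ ((n ℕ.+ k) C k) * sgn k * ((x - 1ℚ) ^ℚ (r ∸ 1 ∸ k))

ψ′ : ℕ → ℕ → ℚ → ℚ
ψ′ r n x = sumBelow r λ k →
  ℕ→ℚ ((n ℕ.+ r) C k) * sgn k * (x ^ℚ (r ∸ 1 ∸ k))

-- Expand (x - 1)^(r+n) binomially in descending powers of x.  Its first r terms are
-- x^(n+1) ψ′ = x^(n+1) ψ, so (x - 1)^(r+n) - x^(n+1) ψ is the tail
-- Σ_{k≤n} C(n+r, r+k) (-1)^(r+k) x^(n-k).  This tail matches S termwise because
-- C(n,k) (n+1)⋯(n+r) = r! C(n+r, r+k) C(r+k, r), both sides being (n+r)!/(k!(n-k)!).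
-- The identity ψ = ψ′ holds since both sides satisfy the same Pascal recursion in r.
module Submission where

open import Defs
open import Data.Nat as ℕ using (ℕ; zero; suc; _≤_; _<_; _!; _∸_; s≤s; >-nonZero)
import Data.Nat.Properties as ℕ
open import Data.Nat.Combinatorics
  using (_C_; nCk≡n!/k![n-k]!; k![n∸k]!∣n!; nCk+nC[k+1]≡[n+1]C[k+1]; k>n⇒nCk≡0; nCn≡1; nC1≡n; nCk≡nC[n∸k])
open import Data.Nat.DivMod using (m/n*n≡m)
open import Data.Nat.Tactic.RingSolver using () renaming (ring to ℕ-ring)
open import Data.Integer as ℤ using (+_)
import Data.Integer.Properties as ℤ
open import Data.Rational using (ℚ; 0ℚ; 1ℚ; _+_; _*_; _-_; -_; _/_; toℚᵘ)
open import Data.Rational.Properties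
  using (_≟_; +-*-commutativeRing; toℚᵘ-injective; toℚᵘ-fromℚᵘ; toℚᵘ-homo-+; toℚᵘ-homo-*; /-cong;
         +-identityʳ; *-identityˡ; *-identityʳ; *-zeroˡ; *-zeroʳ; *-comm; *-assoc; *-distribˡ-+)
open import Data.Rational.Unnormalised as ℚᵘ using (mkℚᵘ; *≡*)
import Data.Rational.Unnormalised.Properties as ℚᵘ
open import Data.Product using (_×_; _,_)
open import Relation.Nullary.Decidable.Core using (dec⇒maybe)
open import Relation.Binary.PropositionalEquality
open import Tactic.RingSolver using (solve-∀)
open import Tactic.RingSolver.Core.AlmostCommutativeRing using (AlmostCommutativeRing; fromCommutativeRing)

ℚ-ring : AlmostCommutativeRing _ _
ℚ-ring = fromCommutativeRing +-*-commutativeRing (λ x → dec⇒maybe (0ℚ ≟ x))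

toℚᵘ-ℕ→ℚ : ∀ m → toℚᵘ (ℕ→ℚ m) ℚᵘ.≃ mkℚᵘ (+ m) 0
toℚᵘ-ℕ→ℚ m = toℚᵘ-fromℚᵘ (mkℚᵘ (+ m) 0)

ℕ→ℚ-+ : ∀ a b → ℕ→ℚ (a ℕ.+ b) ≡ ℕ→ℚ a + ℕ→ℚ b
ℕ→ℚ-+ a b = toℚᵘ-injective (begin
  toℚᵘ (ℕ→ℚ (a ℕ.+ b))            ≈⟨ toℚᵘ-ℕ→ℚ (a ℕ.+ b) ⟩
  mkℚᵘ (+ (a ℕ.+ b)) 0             ≈⟨ *≡* (cong (ℤ._* + 1) (sym (cong₂ ℤ._+_ (ℤ.*-identityʳ (+ a)) (ℤ.*-identityʳ (+ b))))) ⟩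
  mkℚᵘ (+ a) 0 ℚᵘ.+ mkℚᵘ (+ b) 0   ≈⟨ ℚᵘ.≃-sym (ℚᵘ.+-cong (toℚᵘ-ℕ→ℚ a) (toℚᵘ-ℕ→ℚ b)) ⟩
  toℚᵘ (ℕ→ℚ a) ℚᵘ.+ toℚᵘ (ℕ→ℚ b)   ≈⟨ ℚᵘ.≃-sym (toℚᵘ-homo-+ (ℕ→ℚ a) (ℕ→ℚ b)) ⟩
  toℚᵘ (ℕ→ℚ a + ℕ→ℚ b)            ∎)
  where open ℚᵘ.≃-Reasoning

ℕ→ℚ-* : ∀ a b → ℕ→ℚ (a ℕ.* b) ≡ ℕ→ℚ a * ℕ→ℚ b
ℕ→ℚ-* a b = toℚᵘ-injective (begin
  toℚᵘ (ℕ→ℚ (a ℕ.* b))            ≈⟨ toℚᵘ-ℕ→ℚ (a ℕ.* b) ⟩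
  mkℚᵘ (+ (a ℕ.* b)) 0             ≈⟨ *≡* (cong (ℤ._* + 1) (ℤ.pos-* a b)) ⟩
  mkℚᵘ (+ a) 0 ℚᵘ.* mkℚᵘ (+ b) 0   ≈⟨ ℚᵘ.≃-sym (ℚᵘ.*-cong (toℚᵘ-ℕ→ℚ a) (toℚᵘ-ℕ→ℚ b)) ⟩
  toℚᵘ (ℕ→ℚ a) ℚᵘ.* toℚᵘ (ℕ→ℚ b)   ≈⟨ ℚᵘ.≃-sym (toℚᵘ-homo-* (ℕ→ℚ a) (ℕ→ℚ b)) ⟩
  toℚᵘ (ℕ→ℚ a * ℕ→ℚ b)            ∎)
  where open ℚᵘ.≃-Reasoning

ℕ→ℚ-*-inverse : ∀ d .{{_ : ℕ.NonZero d}} → ℕ→ℚ d * (+ 1 / d) ≡ 1ℚ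
ℕ→ℚ-*-inverse (suc d) = toℚᵘ-injective (begin
  toℚᵘ (ℕ→ℚ (suc d) * (+ 1 / suc d))           ≈⟨ toℚᵘ-homo-* (ℕ→ℚ (suc d)) (+ 1 / suc d) ⟩
  toℚᵘ (ℕ→ℚ (suc d)) ℚᵘ.* toℚᵘ (+ 1 / suc d)  ≈⟨ ℚᵘ.*-cong (toℚᵘ-ℕ→ℚ (suc d)) (toℚᵘ-fromℚᵘ (mkℚᵘ (+ 1) d)) ⟩
  mkℚᵘ (+ suc d) 0 ℚᵘ.* mkℚᵘ (+ 1) d           ≈⟨ *≡* (trans (ℤ.*-identityʳ (+ suc d ℤ.* + 1))
                                                    (trans (ℤ.*-identityʳ (+ suc d))
                                                    (trans (cong +_ (sym (ℕ.*-identityˡ (suc d))))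
                                                    (sym (ℤ.*-identityˡ (+ (1 ℕ.* suc d))))))) ⟩
  ℚᵘ.1ℚᵘ                                       ∎)
  where open ℚᵘ.≃-Reasoning

ℕ→ℚ-ratio-cong : ∀ a c B P .{{_ : ℕ.NonZero B}} .{{_ : ℕ.NonZero P}} → a ℕ.* P ≡ c ℕ.* B →
                 ℕ→ℚ a * (+ 1 / B) ≡ ℕ→ℚ c * (+ 1 / P)
ℕ→ℚ-ratio-cong a c B P aP≡cB = begin
  ℕ→ℚ a * 1/B                  ≡⟨ *-identityʳ (ℕ→ℚ a * 1/B) ⟨
  ℕ→ℚ a * 1/B * 1ℚ             ≡⟨ cong (ℕ→ℚ a * 1/B *_) (ℕ→ℚ-*-inverse P) ⟨
  ℕ→ℚ a * 1/B * (ℕ→ℚ P * 1/P)  ≡⟨ interchange (ℕ→ℚ a) 1/B (ℕ→ℚ P) 1/P ⟩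
  ℕ→ℚ a * ℕ→ℚ P * (1/B * 1/P)  ≡⟨ cong (_* (1/B * 1/P)) cross ⟩
  ℕ→ℚ c * ℕ→ℚ B * (1/B * 1/P)  ≡⟨ regroup (ℕ→ℚ c) (ℕ→ℚ B) 1/B 1/P ⟩
  ℕ→ℚ c * 1/P * (ℕ→ℚ B * 1/B)  ≡⟨ cong (ℕ→ℚ c * 1/P *_) (ℕ→ℚ-*-inverse B) ⟩
  ℕ→ℚ c * 1/P * 1ℚ             ≡⟨ *-identityʳ (ℕ→ℚ c * 1/P) ⟩
  ℕ→ℚ c * 1/P                  ∎
  where
  open ≡-Reasoning
  1/B = + 1 / B
  1/P = + 1 / P
  cross : ℕ→ℚ a * ℕ→ℚ P ≡ ℕ→ℚ c * ℕ→ℚ B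
  cross = trans (sym (ℕ→ℚ-* a P)) (trans (cong ℕ→ℚ aP≡cB) (ℕ→ℚ-* c B))
  interchange : ∀ u v w z → u * v * (w * z) ≡ u * w * (v * z)
  interchange = solve-∀ ℚ-ring
  regroup : ∀ u v w z → u * v * (w * z) ≡ u * z * (v * w)
  regroup = solve-∀ ℚ-ring

sumBelow-cong : ∀ m {f g : ℕ → ℚ} → (∀ k → k < m → f k ≡ g k) → sumBelow m f ≡ sumBelow m g
sumBelow-cong zero    f≗g = refl
sumBelow-cong (suc m) f≗g =
  cong₂ _+_ (sumBelow-cong m (λ k k<m → f≗g k (ℕ.m<n⇒m<1+n k<m))) (f≗g m ℕ.≤-refl)

*-distribˡ-sumBelow : ∀ m a (f : ℕ → ℚ) → a * sumBelow m f ≡ sumBelow m (λ k → a * f k)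
*-distribˡ-sumBelow zero    a f = *-zeroʳ a
*-distribˡ-sumBelow (suc m) a f =
  trans (*-distribˡ-+ a (sumBelow m f) (f m)) (cong (_+ a * f m) (*-distribˡ-sumBelow m a f))

*-distribʳ-sumBelow : ∀ m a (f : ℕ → ℚ) → sumBelow m f * a ≡ sumBelow m (λ k → f k * a)
*-distribʳ-sumBelow m a f =
  trans (*-comm (sumBelow m f) a) (trans (*-distribˡ-sumBelow m a f) (sumBelow-cong m (λ k _ → *-comm a (f k))))

horner : (ℕ → ℚ) → ℚ → ℕ → ℚ
horner c x L = sumBelow L (λ k → c k * x ^ℚ (L ∸ 1 ∸ k))

horner-suc : ∀ c x L → horner c x (suc L) ≡ x * horner c x L + c L
horner-suc c x L = cong₂ _+_ shifted top
  where
  move-x : ∀ u w v → u * (w * v) ≡ w * (u * v)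
  move-x = solve-∀ ℚ-ring
  ∸-shift : ∀ {L k} → k < L → L ∸ k ≡ suc (L ∸ 1 ∸ k)
  ∸-shift {suc L} (s≤s k≤L) = ℕ.+-∸-assoc 1 k≤L
  shifted : sumBelow L (λ k → c k * x ^ℚ (L ∸ k)) ≡ x * horner c x L
  shifted = trans (sumBelow-cong L λ k k<L →
                     trans (cong (λ e → c k * x ^ℚ e) (∸-shift k<L)) (move-x (c k) x _))
                  (sym (*-distribˡ-sumBelow L x _))
  top : c L * x ^ℚ (L ∸ L) ≡ c L
  top = trans (cong (λ e → c L * x ^ℚ e) (ℕ.n∸n≡0 L)) (*-identityʳ (c L))

horner-+ : ∀ c x L j → horner c x (L ℕ.+ j) ≡ x ^ℚ j * horner c x L + horner (λ k → c (L ℕ.+ k)) x j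
horner-+ c x L zero = trans (cong (horner c x) (ℕ.+-identityʳ L)) (pad (horner c x L))
  where
  pad : ∀ h → h ≡ 1ℚ * h + 0ℚ
  pad = solve-∀ ℚ-ring
horner-+ c x L (suc j) = begin
  horner c x (L ℕ.+ suc j)               ≡⟨ cong (horner c x) (ℕ.+-suc L j) ⟩
  horner c x (suc (L ℕ.+ j))             ≡⟨ horner-suc c x (L ℕ.+ j) ⟩
  x * horner c x (L ℕ.+ j) + c (L ℕ.+ j) ≡⟨ cong (λ h → x * h + c (L ℕ.+ j)) (horner-+ c x L j) ⟩
  x * (x ^ℚ j * h + t) + c (L ℕ.+ j)     ≡⟨ distrib x (x ^ℚ j) h t (c (L ℕ.+ j)) ⟩
  x * x ^ℚ j * h + (x * t + c (L ℕ.+ j)) ≡⟨ cong (_+_ (x * x ^ℚ j * h)) (horner-suc (λ k → c (L ℕ.+ k)) x j) ⟨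
  x ^ℚ suc j * h + horner (λ k → c (L ℕ.+ k)) x (suc j) ∎
  where
  open ≡-Reasoning
  h = horner c x L
  t = horner (λ k → c (L ℕ.+ k)) x j
  distrib : ∀ x p h t c → x * (p * h + t) + c ≡ x * p * h + (x * t + c)
  distrib = solve-∀ ℚ-ring

sgn-+ : ∀ a b → sgn (a ℕ.+ b) ≡ sgn a * sgn b
sgn-+ zero    b = sym (*-identityˡ (sgn b))
sgn-+ (suc a) b = trans (cong (- 1ℚ *_) (sgn-+ a b)) (sym (*-assoc (- 1ℚ) (sgn a) (sgn b)))

sgn*sgn≡1 : ∀ a → sgn a * sgn a ≡ 1ℚ
sgn*sgn≡1 zero    = refl
sgn*sgn≡1 (suc a) = trans (square (sgn a)) (sgn*sgn≡1 a)
  where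
  square : ∀ s → (- 1ℚ * s) * (- 1ℚ * s) ≡ s * s
  square = solve-∀ ℚ-ring

-- the coefficient of x^(m-k) in (x - 1)^m
signedBinom : ℕ → ℕ → ℚ
signedBinom m k = ℕ→ℚ (m C k) * sgn k

signedBinom-pascal : ∀ m k → signedBinom (suc m) (suc k) ≡ signedBinom m (suc k) - signedBinom m k
signedBinom-pascal m k = begin
  ℕ→ℚ (suc m C suc k) * sgn (suc k)
    ≡⟨ cong (λ c → ℕ→ℚ c * sgn (suc k)) (nCk+nC[k+1]≡[n+1]C[k+1] m k) ⟨
  ℕ→ℚ (m C k ℕ.+ m C suc k) * (- 1ℚ * sgn k)
    ≡⟨ cong (_* (- 1ℚ * sgn k)) (ℕ→ℚ-+ (m C k) (m C suc k)) ⟩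
  (ℕ→ℚ (m C k) + ℕ→ℚ (m C suc k)) * (- 1ℚ * sgn k)
    ≡⟨ expand (ℕ→ℚ (m C k)) (ℕ→ℚ (m C suc k)) (sgn k) ⟩
  ℕ→ℚ (m C suc k) * (- 1ℚ * sgn k) - ℕ→ℚ (m C k) * sgn k ∎
  where
  open ≡-Reasoning
  expand : ∀ a b s → (a + b) * (- 1ℚ * s) ≡ b * (- 1ℚ * s) - a * s
  expand = solve-∀ ℚ-ring

horner-signedBinom-suc : ∀ m L x →
  horner (signedBinom (suc m)) x (suc L) ≡ (x - 1ℚ) * horner (signedBinom m) x L + signedBinom m L
horner-signedBinom-suc m zero x = trans (horner-suc (signedBinom (suc m)) x 0) (zero-terms x (signedBinom m 0))
  where
  zero-terms : ∀ x c → x * 0ℚ + c ≡ (x - 1ℚ) * 0ℚ + c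
  zero-terms = solve-∀ ℚ-ring
horner-signedBinom-suc m (suc L) x = begin
  horner (signedBinom (suc m)) x (suc (suc L))
    ≡⟨ horner-suc (signedBinom (suc m)) x (suc L) ⟩
  x * horner (signedBinom (suc m)) x (suc L) + signedBinom (suc m) (suc L)
    ≡⟨ cong₂ (λ h c → x * h + c) (horner-signedBinom-suc m L x) (signedBinom-pascal m L) ⟩
  x * ((x - 1ℚ) * h + a) + (b - a)
    ≡⟨ regroup x h a b ⟩
  (x - 1ℚ) * (x * h + a) + b
    ≡⟨ cong (λ h′ → (x - 1ℚ) * h′ + b) (horner-suc (signedBinom m) x L) ⟨
  (x - 1ℚ) * horner (signedBinom m) x (suc L) + b ∎
  where
  open ≡-Reasoning
  h = horner (signedBinom m) x L
  a = signedBinom m L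
  b = signedBinom m (suc L)
  regroup : ∀ x h a b → x * ((x - 1ℚ) * h + a) + (b - a) ≡ (x - 1ℚ) * (x * h + a) + b
  regroup = solve-∀ ℚ-ring

binomial-expansion : ∀ m x → (x - 1ℚ) ^ℚ m ≡ horner (signedBinom m) x (suc m)
binomial-expansion zero    x = refl
binomial-expansion (suc m) x = begin
  (x - 1ℚ) * (x - 1ℚ) ^ℚ m                                ≡⟨ cong ((x - 1ℚ) *_) (binomial-expansion m x) ⟩
  (x - 1ℚ) * horner (signedBinom m) x (suc m)             ≡⟨ +-identityʳ _ ⟨
  (x - 1ℚ) * horner (signedBinom m) x (suc m) + 0ℚ        ≡⟨ cong (_+_ ((x - 1ℚ) * horner (signedBinom m) x (suc m))) top ⟨
  (x - 1ℚ) * horner (signedBinom m) x (suc m) + signedBinom m (suc m)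
                                                          ≡⟨ horner-signedBinom-suc m (suc m) x ⟨
  horner (signedBinom (suc m)) x (suc (suc m))            ∎
  where
  open ≡-Reasoning
  top : signedBinom m (suc m) ≡ 0ℚ
  top = trans (cong (λ c → ℕ→ℚ c * sgn (suc m)) (k>n⇒nCk≡0 (ℕ.n<1+n m))) (*-zeroˡ (sgn (suc m)))

-- Definitionally, ψ r n x = horner (λ k → signedBinom (n + k) k) (x - 1) r
-- and ψ′ r n x = horner (signedBinom (n + r)) x r.
ψ≡ψ′ : ∀ r n x → ψ r n x ≡ ψ′ r n x
ψ≡ψ′ zero    n x = refl
ψ≡ψ′ (suc r) n x = begin
  ψ (suc r) n x                                            ≡⟨ horner-suc (λ k → signedBinom (n ℕ.+ k) k) (x - 1ℚ) r ⟩
  (x - 1ℚ) * ψ r n x + signedBinom (n ℕ.+ r) r             ≡⟨ cong (λ p → (x - 1ℚ) * p + signedBinom (n ℕ.+ r) r) (ψ≡ψ′ r n x) ⟩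
  (x - 1ℚ) * ψ′ r n x + signedBinom (n ℕ.+ r) r            ≡⟨ horner-signedBinom-suc (n ℕ.+ r) r x ⟨
  horner (signedBinom (suc (n ℕ.+ r))) x (suc r)           ≡⟨ cong (λ m → horner (signedBinom m) x (suc r)) (ℕ.+-suc n r) ⟨
  ψ′ (suc r) n x                                           ∎
  where open ≡-Reasoning

binomial-tail : ∀ r n x →
  (x - 1ℚ) ^ℚ (r ℕ.+ n) - x ^ℚ (n ℕ.+ 1) * ψ r n x ≡ horner (λ k → signedBinom (n ℕ.+ r) (r ℕ.+ k)) x (suc n)
binomial-tail r n x = begin
  (x - 1ℚ) ^ℚ (r ℕ.+ n) - x ^ℚ (n ℕ.+ 1) * ψ r n x
    ≡⟨ cong₂ (λ e e′ → (x - 1ℚ) ^ℚ e - x ^ℚ e′ * ψ r n x) (ℕ.+-comm r n) (ℕ.+-comm n 1) ⟩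
  (x - 1ℚ) ^ℚ (n ℕ.+ r) - x ^ℚ suc n * ψ r n x
    ≡⟨ cong (λ p → (x - 1ℚ) ^ℚ (n ℕ.+ r) - x ^ℚ suc n * p) (ψ≡ψ′ r n x) ⟩
  (x - 1ℚ) ^ℚ (n ℕ.+ r) - x ^ℚ suc n * ψ′ r n x
    ≡⟨ cong (_- x ^ℚ suc n * ψ′ r n x) (binomial-expansion (n ℕ.+ r) x) ⟩
  horner (signedBinom (n ℕ.+ r)) x (suc (n ℕ.+ r)) - x ^ℚ suc n * ψ′ r n x
    ≡⟨ cong (λ L → horner (signedBinom (n ℕ.+ r)) x L - x ^ℚ suc n * ψ′ r n x) suc[n+r]≡r+suc[n] ⟩
  horner (signedBinom (n ℕ.+ r)) x (r ℕ.+ suc n) - x ^ℚ suc n * ψ′ r n x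
    ≡⟨ cong (_- x ^ℚ suc n * ψ′ r n x) (horner-+ (signedBinom (n ℕ.+ r)) x r (suc n)) ⟩
  x ^ℚ suc n * ψ′ r n x + tail - x ^ℚ suc n * ψ′ r n x
    ≡⟨ cancel (x ^ℚ suc n * ψ′ r n x) tail ⟩
  tail ∎
  where
  open ≡-Reasoning
  tail = horner (λ k → signedBinom (n ℕ.+ r) (r ℕ.+ k)) x (suc n)
  suc[n+r]≡r+suc[n] : suc (n ℕ.+ r) ≡ r ℕ.+ suc n
  suc[n+r]≡r+suc[n] = trans (cong suc (ℕ.+-comm n r)) (sym (ℕ.+-suc r n))
  cancel : ∀ a t → a + t - a ≡ t
  cancel = solve-∀ ℚ-ring

nCk*[k!*j!]≡n! : ∀ k j {n} → k ℕ.+ j ≡ n → (n C k) ℕ.* (k ! ℕ.* j !) ≡ n !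
nCk*[k!*j!]≡n! k j refl =
  subst (λ i → ((k ℕ.+ j) C k) ℕ.* (k ! ℕ.* i !) ≡ (k ℕ.+ j) !) (ℕ.m+n∸m≡n k j)
    (trans (cong (ℕ._* (k ! ℕ.* (k ℕ.+ j ∸ k) !)) (nCk≡n!/k![n-k]! k≤k+j))
           (m/n*n≡m {{k ℕ.!* (k ℕ.+ j ∸ k) !≢0}} (k![n∸k]!∣n! k≤k+j)))
  where
  k≤k+j : k ≤ k ℕ.+ j
  k≤k+j = ℕ.m≤m+n k j

n!*risingProd≡[n+r]! : ∀ n r → n ! ℕ.* risingProd n r ≡ (n ℕ.+ r) !
n!*risingProd≡[n+r]! n zero    = trans (ℕ.*-identityʳ (n !)) (cong _! (sym (ℕ.+-identityʳ n)))
n!*risingProd≡[n+r]! n (suc r) = begin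
  n ! ℕ.* (risingProd n r ℕ.* (n ℕ.+ suc r)) ≡⟨ ℕ.*-assoc (n !) (risingProd n r) (n ℕ.+ suc r) ⟨
  n ! ℕ.* risingProd n r ℕ.* (n ℕ.+ suc r)   ≡⟨ cong₂ ℕ._*_ (n!*risingProd≡[n+r]! n r) (ℕ.+-suc n r) ⟩
  (n ℕ.+ r) ! ℕ.* suc (n ℕ.+ r)              ≡⟨ ℕ.*-comm ((n ℕ.+ r) !) (suc (n ℕ.+ r)) ⟩
  suc (n ℕ.+ r) !                            ≡⟨ cong _! (ℕ.+-suc n r) ⟨
  (n ℕ.+ suc r) !                            ∎
  where open ≡-Reasoning

nCk*risingProd≡r!*[n+r]C[r+k]*[r+k]Cr : ∀ n r k → k ≤ n →
  (n C k) ℕ.* risingProd n r ≡ r ! ℕ.* ((n ℕ.+ r) C (r ℕ.+ k)) ℕ.* ((r ℕ.+ k) C r)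
nCk*risingProd≡r!*[n+r]C[r+k]*[r+k]Cr n r k k≤n =
  ℕ.*-cancelʳ-≡ _ _ (k ! ℕ.* (n ∸ k) !) {{k ℕ.!* (n ∸ k) !≢0}} (trans lhs (sym rhs))
  where
  open ≡-Reasoning
  swap : ∀ a b c → a ℕ.* b ℕ.* c ≡ a ℕ.* c ℕ.* b
  swap = solve-∀ ℕ-ring
  regroup : ∀ a b c d e → a ℕ.* b ℕ.* c ℕ.* (d ℕ.* e) ≡ b ℕ.* (c ℕ.* (a ℕ.* d) ℕ.* e)
  regroup = solve-∀ ℕ-ring
  r+k+[n∸k]≡n+r : r ℕ.+ k ℕ.+ (n ∸ k) ≡ n ℕ.+ r
  r+k+[n∸k]≡n+r = trans (ℕ.+-assoc r k (n ∸ k)) (trans (cong (r ℕ.+_) (ℕ.m+[n∸m]≡n k≤n)) (ℕ.+-comm r n))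
  lhs : (n C k) ℕ.* risingProd n r ℕ.* (k ! ℕ.* (n ∸ k) !) ≡ (n ℕ.+ r) !
  lhs = begin
    (n C k) ℕ.* risingProd n r ℕ.* (k ! ℕ.* (n ∸ k) !) ≡⟨ swap (n C k) (risingProd n r) (k ! ℕ.* (n ∸ k) !) ⟩
    (n C k) ℕ.* (k ! ℕ.* (n ∸ k) !) ℕ.* risingProd n r ≡⟨ cong (ℕ._* risingProd n r) (nCk*[k!*j!]≡n! k (n ∸ k) (ℕ.m+[n∸m]≡n k≤n)) ⟩
    n ! ℕ.* risingProd n r                             ≡⟨ n!*risingProd≡[n+r]! n r ⟩
    (n ℕ.+ r) !                                        ∎
  rhs : r ! ℕ.* ((n ℕ.+ r) C (r ℕ.+ k)) ℕ.* ((r ℕ.+ k) C r) ℕ.* (k ! ℕ.* (n ∸ k) !) ≡ (n ℕ.+ r) !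
  rhs = begin
    r ! ℕ.* ((n ℕ.+ r) C (r ℕ.+ k)) ℕ.* ((r ℕ.+ k) C r) ℕ.* (k ! ℕ.* (n ∸ k) !)
      ≡⟨ regroup (r !) ((n ℕ.+ r) C (r ℕ.+ k)) ((r ℕ.+ k) C r) (k !) ((n ∸ k) !) ⟩
    ((n ℕ.+ r) C (r ℕ.+ k)) ℕ.* (((r ℕ.+ k) C r) ℕ.* (r ! ℕ.* k !) ℕ.* (n ∸ k) !)
      ≡⟨ cong (λ f → ((n ℕ.+ r) C (r ℕ.+ k)) ℕ.* (f ℕ.* (n ∸ k) !)) (nCk*[k!*j!]≡n! r k refl) ⟩
    ((n ℕ.+ r) C (r ℕ.+ k)) ℕ.* ((r ℕ.+ k) ! ℕ.* (n ∸ k) !)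
      ≡⟨ nCk*[k!*j!]≡n! (r ℕ.+ k) (n ∸ k) r+k+[n∸k]≡n+r ⟩
    (n ℕ.+ r) ! ∎

S-term≡ : ∀ r n k x → k ≤ n →
  ℕ→ℚ (n C k) * sgn k * x ^ℚ (n ∸ k) * invBinom r k
    ≡ sgn r * ℕ→ℚ (r !) * (signedBinom (n ℕ.+ r) (r ℕ.+ k) * x ^ℚ (n ∸ k) * invRising n r)
S-term≡ r n k x k≤n = begin
  ℕ→ℚ (n C k) * sgn k * X * invBinom r k
    ≡⟨ cong (λ s → ℕ→ℚ (n C k) * s * X * invBinom r k) sgn-k ⟩
  ℕ→ℚ (n C k) * (sgn r * sgn (r ℕ.+ k)) * X * invBinom r k
    ≡⟨ pull-out (ℕ→ℚ (n C k)) (sgn r) (sgn (r ℕ.+ k)) X (invBinom r k) ⟩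
  sgn r * (ℕ→ℚ (n C k) * invBinom r k) * (sgn (r ℕ.+ k) * X)
    ≡⟨ cong (λ q → sgn r * q * (sgn (r ℕ.+ k) * X)) ratio ⟩
  sgn r * (ℕ→ℚ (r !) * ℕ→ℚ Cnr * invRising n r) * (sgn (r ℕ.+ k) * X)
    ≡⟨ push-in (sgn r) (ℕ→ℚ (r !)) (ℕ→ℚ Cnr) (invRising n r) (sgn (r ℕ.+ k)) X ⟩
  sgn r * ℕ→ℚ (r !) * (ℕ→ℚ Cnr * sgn (r ℕ.+ k) * X * invRising n r) ∎
  where
  open ≡-Reasoning
  X = x ^ℚ (n ∸ k)
  Cnr = (n ℕ.+ r) C (r ℕ.+ k)
  sgn-k : sgn k ≡ sgn r * sgn (r ℕ.+ k)
  sgn-k = begin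
    sgn k                          ≡⟨ *-identityˡ (sgn k) ⟨
    1ℚ * sgn k                     ≡⟨ cong (_* sgn k) (sgn*sgn≡1 r) ⟨
    sgn r * sgn r * sgn k          ≡⟨ *-assoc (sgn r) (sgn r) (sgn k) ⟩
    sgn r * (sgn r * sgn k)        ≡⟨ cong (sgn r *_) (sgn-+ r k) ⟨
    sgn r * sgn (r ℕ.+ k)          ∎
  ratio : ℕ→ℚ (n C k) * invBinom r k ≡ ℕ→ℚ (r !) * ℕ→ℚ Cnr * invRising n r
  ratio = trans
    (ℕ→ℚ-ratio-cong (n C k) (r ! ℕ.* Cnr) ((r ℕ.+ k) C r) (risingProd n r)
       {{>-nonZero (C-pos (r ℕ.+ k) r (ℕ.m≤m+n r k))}} {{>-nonZero (risingProd-pos n r)}}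
       (nCk*risingProd≡r!*[n+r]C[r+k]*[r+k]Cr n r k k≤n))
    (cong (_* invRising n r) (ℕ→ℚ-* (r !) Cnr))
  pull-out : ∀ a s t X b → a * (s * t) * X * b ≡ s * (a * b) * (t * X)
  pull-out = solve-∀ ℚ-ring
  push-in : ∀ s f c i t X → s * (f * c * i) * (t * X) ≡ s * f * (c * t * X * i)
  push-in = solve-∀ ℚ-ring

S≡closedForm : ∀ r n x →
  S r n x ≡ sgn r * ℕ→ℚ (r !) * (((x - 1ℚ) ^ℚ (r ℕ.+ n) - x ^ℚ (n ℕ.+ 1) * ψ r n x) * invRising n r)
S≡closedForm r n x = begin
  S r n x
    ≡⟨ sumBelow-cong (suc n) (λ k k<1+n → S-term≡ r n k x (ℕ.≤-pred k<1+n)) ⟩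
  sumBelow (suc n) (λ k → c * (tail k * invRising n r))
    ≡⟨ *-distribˡ-sumBelow (suc n) c (λ k → tail k * invRising n r) ⟨
  c * sumBelow (suc n) (λ k → tail k * invRising n r)
    ≡⟨ cong (c *_) (*-distribʳ-sumBelow (suc n) (invRising n r) tail) ⟨
  c * (horner (λ k → signedBinom (n ℕ.+ r) (r ℕ.+ k)) x (suc n) * invRising n r)
    ≡⟨ cong (λ t → c * (t * invRising n r)) (binomial-tail r n x) ⟨
  c * (((x - 1ℚ) ^ℚ (r ℕ.+ n) - x ^ℚ (n ℕ.+ 1) * ψ r n x) * invRising n r) ∎
  where
  open ≡-Reasoning
  c = sgn r * ℕ→ℚ (r !)
  tail : ℕ → ℚ
  tail k = signedBinom (n ℕ.+ r) (r ℕ.+ k) * x ^ℚ (n ∸ k)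

S-1≡ : ∀ n x → S 1 n x ≡ (x ^ℚ (n ℕ.+ 1) - (x - 1ℚ) ^ℚ (n ℕ.+ 1)) * (+ 1 / suc n)
S-1≡ n x = begin
  S 1 n x
    ≡⟨ S≡closedForm 1 n x ⟩
  sgn 1 * ℕ→ℚ (1 !) * (((x - 1ℚ) ^ℚ (1 ℕ.+ n) - x ^ℚ (n ℕ.+ 1) * ψ 1 n x) * invRising n 1)
    ≡⟨ cong₂ (λ e i → sgn 1 * ℕ→ℚ (1 !) * (((x - 1ℚ) ^ℚ e - x ^ℚ (n ℕ.+ 1) * ψ 1 n x) * i))
             (ℕ.+-comm 1 n) invRising-n-1 ⟩
  sgn 1 * ℕ→ℚ (1 !) * (((x - 1ℚ) ^ℚ (n ℕ.+ 1) - x ^ℚ (n ℕ.+ 1) * ψ 1 n x) * (+ 1 / suc n))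
    -- sgn 1, ℕ→ℚ (1 !) and ψ 1 n x compute to - 1ℚ * 1ℚ, 1ℚ and 1ℚ
    ≡⟨ negate ((x - 1ℚ) ^ℚ (n ℕ.+ 1)) (x ^ℚ (n ℕ.+ 1)) (+ 1 / suc n) ⟩
  (x ^ℚ (n ℕ.+ 1) - (x - 1ℚ) ^ℚ (n ℕ.+ 1)) * (+ 1 / suc n) ∎
  where
  open ≡-Reasoning
  invRising-n-1 : invRising n 1 ≡ + 1 / suc n
  invRising-n-1 = /-cong {p₁ = + 1} {p₂ = + 1} {{>-nonZero (risingProd-pos n 1)}} refl
    (trans (ℕ.*-identityˡ (n ℕ.+ 1)) (ℕ.+-comm n 1))
  negate : ∀ p q i → - 1ℚ * 1ℚ * 1ℚ * ((p - q * 1ℚ) * i) ≡ (q - p) * i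
  negate = solve-∀ ℚ-ring

S-r1≡ : ∀ r x → S r 1 x ≡ x - (+ 1 / suc r)
S-r1≡ r x = trans
  -- S r 1 x unfolds to its two summands, with the closed binomials and signs evaluated
  (cong₂ (λ u v → 0ℚ + 1ℚ * 1ℚ * (x * 1ℚ) * u + 1ℚ * (- 1ℚ * 1ℚ) * 1ℚ * v) invBinom-r-0 invBinom-r-1)
  (simplify x (+ 1 / suc r))
  where
  invBinom-r-0 : invBinom r 0 ≡ 1ℚ
  invBinom-r-0 = /-cong {p₁ = + 1} {p₂ = + 1} {{>-nonZero (C-pos (r ℕ.+ 0) r (ℕ.m≤m+n r 0))}} refl
    (trans (cong (_C r) (ℕ.+-identityʳ r)) (nCn≡1 r))
  invBinom-r-1 : invBinom r 1 ≡ + 1 / suc r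
  invBinom-r-1 = /-cong {p₁ = + 1} {p₂ = + 1} {{>-nonZero (C-pos (r ℕ.+ 1) r (ℕ.m≤m+n r 1))}} refl (begin
    (r ℕ.+ 1) C r               ≡⟨ nCk≡nC[n∸k] (ℕ.m≤m+n r 1) ⟩
    (r ℕ.+ 1) C (r ℕ.+ 1 ∸ r)   ≡⟨ cong ((r ℕ.+ 1) C_) (ℕ.m+n∸m≡n r 1) ⟩
    (r ℕ.+ 1) C 1               ≡⟨ nC1≡n (r ℕ.+ 1) ⟩
    r ℕ.+ 1                     ≡⟨ ℕ.+-comm r 1 ⟩
    suc r                       ∎)
    where open ≡-Reasoning
  simplify : ∀ x i → 0ℚ + 1ℚ * 1ℚ * (x * 1ℚ) * 1ℚ + 1ℚ * (- 1ℚ * 1ℚ) * 1ℚ * i ≡ x - i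
  simplify = solve-∀ ℚ-ring

1ℚ^ℚm≡1ℚ : ∀ m → 1ℚ ^ℚ m ≡ 1ℚ
1ℚ^ℚm≡1ℚ zero    = refl
1ℚ^ℚm≡1ℚ (suc m) = trans (*-identityˡ (1ℚ ^ℚ m)) (1ℚ^ℚm≡1ℚ m)

S-at-2≡ : ∀ r n → S r n (+ 2 / 1) ≡ sgn r * ℕ→ℚ (r !)
  * ((1ℚ - (+ 2 / 1) ^ℚ (n ℕ.+ 1) * sumBelow r (λ k → sgn k * ℕ→ℚ ((n ℕ.+ k) C k))) * invRising n r)
-- (+ 2 / 1) - 1ℚ computes to 1ℚ
S-at-2≡ r n = trans (S≡closedForm r n (+ 2 / 1))
  (cong₂ (λ p s → sgn r * ℕ→ℚ (r !) * ((p - (+ 2 / 1) ^ℚ (n ℕ.+ 1) * s) * invRising n r))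
    (1ℚ^ℚm≡1ℚ (r ℕ.+ n))
    (sumBelow-cong r λ k _ → trans (cong (ℕ→ℚ ((n ℕ.+ k) C k) * sgn k *_) (1ℚ^ℚm≡1ℚ (r ∸ 1 ∸ k)))
                                    (drop-1 (ℕ→ℚ ((n ℕ.+ k) C k)) (sgn k))))
  where
  drop-1 : ∀ a s → a * s * 1ℚ ≡ s * a
  drop-1 = solve-∀ ℚ-ring

theorem2p7 : (r n : ℕ) → 1 ≤ r → 1 ≤ n →
    ((x : ℚ) →
      S r n x ≡ sgn r * ℕ→ℚ (r !)
        * (((x - 1ℚ) ^ℚ (r ℕ.+ n) - (x ^ℚ (n ℕ.+ 1)) * ψ r n x) * invRising n r))
    × ((x : ℚ) → ψ r n x ≡ ψ′ r n x)
    × ((x : ℚ) →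
      S 1 n x ≡ ((x ^ℚ (n ℕ.+ 1)) - ((x - 1ℚ) ^ℚ (n ℕ.+ 1))) * (+ 1 / suc n))
    × ((x : ℚ) → S r 1 x ≡ x - (+ 1 / suc r))
    × (S r n (+ 2 / 1) ≡ sgn r * ℕ→ℚ (r !)
        * ((1ℚ - ((+ 2 / 1) ^ℚ (n ℕ.+ 1))
                 * sumBelow r (λ k → sgn k * ℕ→ℚ ((n ℕ.+ k) C k)))
           * invRising n r))
theorem2p7 r n _ _ = S≡closedForm r n , ψ≡ψ′ r n , S-1≡ n , S-r1≡ r , S-at-2≡ r n
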